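{- Let $\mathbb{N}=\{1,2,3,\ldots\}$, let $f:\mathbb{N}\times\mathbb{N}\to\mathbb{N}$ be the function $f(n,m)=2^n m$, and let $\mathcal{U}$ be any ultrafilter on $\mathbb{N}$ that satisfies the following property: ($\dagger$) for every $A\in\mathcal{U}$ and for every $L\in\mathbb{N}$ there exist $b,c\in\mathbb{N}$ such that $b, c, b+\ell c\in A$ for every $\ell\le L$. Then for every $A\in f_*(\mathcal{U}\otimes\mathcal{U})$ there exists an infinite sequence $(a_n)_{n\ge 1}$ of natural numbers with the property that for all $i,j,k$ with $i<2j$ and $2j+1<k$, setting $x:=2^{a_i}a_{2j}$ and $y:=2^{a_{2j+1}}a_k$, we have $\{x, y, 2^x y\}\subseteq A$.
   Context: For an ultrafilter $\mathcal{U}$ on a set $I$ and a function $g:I\to J$, the image ultrafilter $g_*(\mathcal{U})$ on $J$ is defined by $B\in g_*(\mathcal{U})\iff g^{ -1}(B)\in\mathcal{U}$. For ultrafilters $\mathcal{U},\mathcal{V}$ on sets $I,J$, the tensor product $\mathcal{U}\otimes\mathcal{V}$ is the ultrafilter on $I\times J$ defined by $X\in\mathcal{U}\otimes\mathcal{V}\iff \{i\in I\mid \{j\in J\mid (i,j)\in X\}\in\mathcal{V}\}\in\mathcal{U}$. -}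

module Defs where

open import Level using (0ℓ)
open import Data.Nat using (ℕ; zero; suc; _+_; _*_; _^_; _≤_; _<_)
open import Data.Product using (Σ; _×_; _,_)
open import Data.Sum using (_⊎_)
open import Data.Empty using (⊥)
open import Data.Unit using (⊤)
open import Relation.Nullary using (¬_)
open import Relation.Unary using (Pred; _⊆_; _∩_; ∁)

Subset : Set → Set₁
Subset I = Pred I 0ℓ

record Ultrafilter (I : Set) : Set₁ where
  field
    _∈U       : Subset I → Set
    upward    : ∀ {A B : Subset I} → A ⊆ B → A ∈U → B ∈U
    intersect : ∀ {A B : Subset I} → A ∈U → B ∈U → (λ i → A i × B i) ∈U
    full      : (λ (_ : I) → ⊤) ∈U
    proper    : ¬ ((λ (_ : I) → ⊥) ∈U)
    ultra     : ∀ (A : Subset I) → A ∈U ⊎ (∁ A) ∈U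

open Ultrafilter public

image : {I J : Set} → (I → J) → (Subset I → Set) → Subset J → Set
image g U B = U (λ i → B (g i))

tensor : {I J : Set} → (Subset I → Set) → (Subset J → Set) → Subset (I × J) → Set
tensor U V X = U (λ i → V (λ j → X (i , j)))

record ℕ⁺ : Set where
  constructor ⟨_,_⟩
  field
    val : ℕ
    pos : 1 ≤ val

open ℕ⁺ public

private
  +-pos : ∀ {m n} → 1 ≤ m → 1 ≤ m + n
  +-pos {suc m} _ = Data.Nat.s≤s Data.Nat.z≤n

  *-pos : ∀ {m n} → 1 ≤ m → 1 ≤ n → 1 ≤ m * n
  *-pos {suc m} {suc n} _ _ = Data.Nat.s≤s Data.Nat.z≤n

  2^-pos : ∀ n → 1 ≤ 2 ^ n
  2^-pos zero    = Data.Nat.s≤s Data.Nat.z≤n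
  2^-pos (suc n) = *-pos {2} {2 ^ n} (Data.Nat.s≤s Data.Nat.z≤n) (2^-pos n)

_+⁺_ : ℕ⁺ → ℕ⁺ → ℕ⁺
⟨ m , p ⟩ +⁺ ⟨ n , q ⟩ = ⟨ m + n , +-pos p ⟩

_*⁺_ : ℕ⁺ → ℕ⁺ → ℕ⁺
⟨ m , p ⟩ *⁺ ⟨ n , q ⟩ = ⟨ m * n , *-pos p q ⟩

2^⁺ : ℕ⁺ → ℕ⁺
2^⁺ ⟨ n , _ ⟩ = ⟨ 2 ^ n , 2^-pos n ⟩

f : ℕ⁺ × ℕ⁺ → ℕ⁺
f (n , m) = 2^⁺ n *⁺ m

Dagger : Ultrafilter ℕ⁺ → Set₁
Dagger U = ∀ (A : Subset ℕ⁺) → (U ∈U) A → ∀ (L : ℕ⁺) →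
  Σ ℕ⁺ λ b → Σ ℕ⁺ λ c →
    A b × A c × (∀ (ℓ : ℕ⁺) → val ℓ ≤ val L → A (b +⁺ (ℓ *⁺ c)))

one⁺ : ℕ⁺
one⁺ = ⟨ 1 , Data.Nat.s≤s Data.Nat.z≤n ⟩

double⁺ : ℕ⁺ → ℕ⁺
double⁺ n = ⟨ 2 , Data.Nat.s≤s Data.Nat.z≤n ⟩ *⁺ n

{-# OPTIONS --safe #-}
-- Let B n = {m | 2^n m ∈ A}, so S = {n | B n ∈ U} ∈ U. Build decreasing sets
-- D t ∈ U inside S together with bounds L t: (†) applied to D t and L t gives c t
-- and b t, and D (t+1) keeps those m ∈ D t lying in B (c t), B (b t) and
-- B (b t + ℓ c t) for all ℓ ≤ L t, finitely many sets of U since c t, b t and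
-- b t + ℓ c t lie in S. The sequence c 0, b 0, c 1, b 1, … works because
-- 2^x y = 2^(b j + 2^(a i) c j) a k, a later a k lies in D (j+1), and the bounds
-- grow fast enough that ℓ = 2^(a i) ≤ L j for every earlier index i.
module Submission where

open import Defs
open import Data.Nat using (ℕ; zero; suc; _+_; _*_; _^_; _<_; _≤_; _≤′_; ≤′-refl; ≤′-step; ⌊_/2⌋; s≤s)
open import Data.Nat.Properties
  using (≤-irrelevant; n≮0; ≤-refl; ≤-trans; ≤-pred; m≤n⇒m≤1+n; m≤n⇒m<n∨m≡n; m≤m+n; m≤n+m;
         ≤⇒≤′; +-comm; *-assoc; *-comm; *-suc; ^-distribˡ-+-*; ⌊n/2⌋-mono)
open import Data.Product using (Σ; _×_; _,_; proj₁; proj₂)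
open import Data.Sum using (inj₁; inj₂)
open import Data.Empty using (⊥-elim)
open import Function using (_∘_)
open import Relation.Unary using (_⊆_)
open import Relation.Binary.PropositionalEquality

val-injective : ∀ {p q : ℕ⁺} → val p ≡ val q → p ≡ q
val-injective {⟨ v , h ⟩} {⟨ .v , h′ ⟩} refl = cong ⟨ v ,_⟩ (≤-irrelevant h h′)

f-merge : ∀ x b m → f (x , f (b , m)) ≡ f (b +⁺ x , m)
f-merge x b m = val-injective (begin
  2 ^ val x * (2 ^ val b * val m)  ≡⟨ *-assoc (2 ^ val x) (2 ^ val b) (val m) ⟨
  2 ^ val x * 2 ^ val b * val m    ≡⟨ cong (_* val m) (*-comm (2 ^ val x) (2 ^ val b)) ⟩
  2 ^ val b * 2 ^ val x * val m    ≡⟨ cong (_* val m) (^-distribˡ-+-* 2 (val b) (val x)) ⟨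
  2 ^ (val b + val x) * val m      ∎)
  where open ≡-Reasoning

⋂≤-∈U : ∀ {I} (U : Ultrafilter I) (P : ℕ⁺ → Subset I) L →
        (∀ ℓ → val ℓ ≤ L → (U ∈U) (P ℓ)) → (U ∈U) (λ i → ∀ ℓ → val ℓ ≤ L → P ℓ i)
⋂≤-∈U U P zero _ = upward U (λ _ ℓ ℓ≤0 → ⊥-elim (n≮0 (≤-trans (pos ℓ) ℓ≤0))) (full U)
⋂≤-∈U U P (suc L) P∈U =
  upward U extend (intersect U (⋂≤-∈U U P L (λ ℓ ℓ≤L → P∈U ℓ (m≤n⇒m≤1+n ℓ≤L))) (P∈U top ≤-refl))
  where
    top : ℕ⁺
    top = ⟨ suc L , s≤s _≤_.z≤n ⟩
    extend : ∀ {i} → (∀ ℓ → val ℓ ≤ L → P ℓ i) × P top i → ∀ ℓ → val ℓ ≤ suc L → P ℓ i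
    extend (below , at-top) ℓ ℓ≤1+L with m≤n⇒m<n∨m≡n ℓ≤1+L
    ... | inj₁ ℓ<1+L = below ℓ (≤-pred ℓ<1+L)
    ... | inj₂ ℓ≡1+L = subst (λ ℓ′ → P ℓ′ _) (sym (val-injective ℓ≡1+L)) at-top

⌊2*n/2⌋≡n : ∀ n → ⌊ 2 * n /2⌋ ≡ n
⌊2*n/2⌋≡n zero = refl
⌊2*n/2⌋≡n (suc n) = trans (cong ⌊_/2⌋ (*-suc 2 n)) (cong suc (⌊2*n/2⌋≡n n))

⌊1+2*n/2⌋≡n : ∀ n → ⌊ suc (2 * n) /2⌋ ≡ n
⌊1+2*n/2⌋≡n zero = refl
⌊1+2*n/2⌋≡n (suc n) = trans (cong (⌊_/2⌋ ∘ suc) (*-suc 2 n)) (cong suc (⌊1+2*n/2⌋≡n n))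

<2*n⇒⌊/2⌋<n : ∀ {m n} → m < 2 * n → ⌊ m /2⌋ < n
<2*n⇒⌊/2⌋<n {m} {n} m<2n = subst (suc ⌊ m /2⌋ ≤_) (⌊1+2*n/2⌋≡n n) (⌊n/2⌋-mono (s≤s m<2n))

2*n+1<⇒n<⌊/2⌋ : ∀ {m n} → 2 * n + 1 < m → n < ⌊ m /2⌋
2*n+1<⇒n<⌊/2⌋ {m} {n} 2n+1<m =
  subst (_≤ ⌊ m /2⌋) (cong suc (⌊2*n/2⌋≡n n))
        (⌊n/2⌋-mono (subst (λ k → suc k ≤ m) (+-comm (2 * n) 1) 2n+1<m))

interleave : {X : Set} → (ℕ → X) → (ℕ → X) → ℕ → X
interleave c b zero          = c zero
interleave c b (suc zero)    = b zero
interleave c b (suc (suc n)) = interleave (c ∘ suc) (b ∘ suc) n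

interleave-even : ∀ {X} (c b : ℕ → X) t → interleave c b (2 * t) ≡ c t
interleave-even c b zero = refl
interleave-even c b (suc t) =
  trans (cong (interleave c b) (*-suc 2 t)) (interleave-even (c ∘ suc) (b ∘ suc) t)

interleave-odd : ∀ {X} (c b : ℕ → X) t → interleave c b (2 * t + 1) ≡ b t
interleave-odd c b zero = refl
interleave-odd c b (suc t) =
  trans (cong (λ k → interleave c b (k + 1)) (*-suc 2 t)) (interleave-odd (c ∘ suc) (b ∘ suc) t)

interleave-elim : ∀ {X} (P : ℕ → X → Set) {c b : ℕ → X} →
                  (∀ s → P s (c s)) → (∀ s → P s (b s)) → ∀ n → P ⌊ n /2⌋ (interleave c b n)
interleave-elim P Pc Pb zero          = Pc zero
interleave-elim P Pc Pb (suc zero)    = Pb zero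
interleave-elim P Pc Pb (suc (suc n)) = interleave-elim (P ∘ suc) (Pc ∘ suc) (Pb ∘ suc) n

module Construction (U : Ultrafilter ℕ⁺) (dagger : Dagger U) (B : ℕ⁺ → Subset ℕ⁺)
                    (S∈U : (U ∈U) (λ n → (U ∈U) (B n))) where

  S : Subset ℕ⁺
  S n = (U ∈U) (B n)

  record Stage : Set₁ where
    field
      D   : Subset ℕ⁺
      D∈U : (U ∈U) D
      D⊆S : D ⊆ S
      L   : ℕ⁺

  open Stage

  b c : Stage → ℕ⁺
  b s = proj₁ (dagger (D s) (D∈U s) (L s))
  c s = proj₁ (proj₂ (dagger (D s) (D∈U s) (L s)))

  b∈D : ∀ s → D s (b s)
  b∈D s = proj₁ (proj₂ (proj₂ (dagger (D s) (D∈U s) (L s))))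

  c∈D : ∀ s → D s (c s)
  c∈D s = proj₁ (proj₂ (proj₂ (proj₂ (dagger (D s) (D∈U s) (L s)))))

  b+ℓc∈D : ∀ s ℓ → val ℓ ≤ val (L s) → D s (b s +⁺ (ℓ *⁺ c s))
  b+ℓc∈D s = proj₂ (proj₂ (proj₂ (proj₂ (dagger (D s) (D∈U s) (L s)))))

  -- The new bound exceeds 2^(c s) and 2^(b s), the values of ℓ that c s and b s
  -- will later contribute as the index i.
  next : Stage → Stage
  next s = record
    { D   = λ m → D s m × B (c s) m × B (b s) m × (∀ ℓ → val ℓ ≤ val (L s) → B (b s +⁺ (ℓ *⁺ c s)) m)
    ; D∈U = intersect U (D∈U s) (intersect U (D⊆S s (c∈D s)) (intersect U (D⊆S s (b∈D s))
              (⋂≤-∈U U _ (val (L s)) (λ ℓ ℓ≤L → D⊆S s (b+ℓc∈D s ℓ ℓ≤L)))))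
    ; D⊆S = D⊆S s ∘ proj₁
    ; L   = L s +⁺ (2^⁺ (c s) +⁺ 2^⁺ (b s))
    }

  stage : ℕ → Stage
  stage zero    = record { D = S ; D∈U = S∈U ; D⊆S = λ n∈S → n∈S ; L = one⁺ }
  stage (suc t) = next (stage t)

  D-antitone : ∀ {s t} → s ≤′ t → D (stage t) ⊆ D (stage s)
  D-antitone ≤′-refl         m∈D = m∈D
  D-antitone (≤′-step s≤′t) m∈D = D-antitone s≤′t (proj₁ m∈D)

  L-monotone : ∀ {s t} → s ≤′ t → val (L (stage s)) ≤ val (L (stage t))
  L-monotone ≤′-refl         = ≤-refl
  L-monotone (≤′-step s≤′t) = ≤-trans (L-monotone s≤′t) (m≤m+n _ _)

  Handled : ℕ → ℕ⁺ → Set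
  Handled t e = D (stage t) ⊆ B e × 2 ^ val e ≤ val (L (stage t))

  Handled-mono : ∀ {s t e} → s ≤ t → Handled s e → Handled t e
  Handled-mono s≤t (D⊆B , 2^e≤L) =
    (D⊆B ∘ D-antitone (≤⇒≤′ s≤t)) , ≤-trans 2^e≤L (L-monotone (≤⇒≤′ s≤t))

  c-handled : ∀ t → Handled (suc t) (c (stage t))
  c-handled t = proj₁ ∘ proj₂ , ≤-trans (m≤m+n 2^c 2^b) (m≤n+m (2^c + 2^b) (val (L (stage t))))
    where 2^c = 2 ^ val (c (stage t)); 2^b = 2 ^ val (b (stage t))

  b-handled : ∀ t → Handled (suc t) (b (stage t))
  b-handled t = proj₁ ∘ proj₂ ∘ proj₂ , ≤-trans (m≤n+m 2^b 2^c) (m≤n+m (2^c + 2^b) (val (L (stage t))))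
    where 2^c = 2 ^ val (c (stage t)); 2^b = 2 ^ val (b (stage t))

  a : ℕ → ℕ⁺
  a = interleave (c ∘ stage) (b ∘ stage)

  a-stage : ∀ n → D (stage ⌊ n /2⌋) (a n) × Handled (suc ⌊ n /2⌋) (a n)
  a-stage = interleave-elim (λ s e → D (stage s) e × Handled (suc s) e)
              (λ s → c∈D (stage s) , c-handled s) (λ s → b∈D (stage s) , b-handled s)

  a-shape : ∀ i j k → i < 2 * j → 2 * j + 1 < k →
    B (a i) (a (2 * j)) × B (a (2 * j + 1)) (a k) × B (a (2 * j + 1) +⁺ (2^⁺ (a i) *⁺ a (2 * j))) (a k)
  a-shape i j k i<2j 2j+1<k
    rewrite interleave-even (c ∘ stage) (b ∘ stage) j | interleave-odd (c ∘ stage) (b ∘ stage) j =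
      D⊆Bai (c∈D (stage j)) , ak∈Bb , ak∈Bb+ℓc (2^⁺ (a i)) 2^ai≤L
    where
      ai-handled : Handled j (a i)
      ai-handled = Handled-mono (<2*n⇒⌊/2⌋<n {n = j} i<2j) (proj₂ (a-stage i))
      D⊆Bai : D (stage j) ⊆ B (a i)
      D⊆Bai = proj₁ ai-handled
      2^ai≤L : 2 ^ val (a i) ≤ val (L (stage j))
      2^ai≤L = proj₂ ai-handled
      ak∈D : D (stage (suc j)) (a k)
      ak∈D = D-antitone (≤⇒≤′ (2*n+1<⇒n<⌊/2⌋ {n = j} 2j+1<k)) (proj₁ (a-stage k))
      ak∈Bb : B (b (stage j)) (a k)
      ak∈Bb = proj₁ (proj₂ (proj₂ ak∈D))
      ak∈Bb+ℓc : ∀ ℓ → val ℓ ≤ val (L (stage j)) → B (b (stage j) +⁺ (ℓ *⁺ c (stage j))) (a k)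
      ak∈Bb+ℓc = proj₂ (proj₂ (proj₂ ak∈D))

theorem2 : (U : Ultrafilter ℕ⁺) → Dagger U →
    ∀ (A : Subset ℕ⁺) → image f (tensor (U ∈U) (U ∈U)) A →
    Σ (ℕ⁺ → ℕ⁺) λ a →
      ∀ (i j k : ℕ⁺) → val i < val (double⁺ j) → val (double⁺ j +⁺ one⁺) < val k →
        let x = f (a i , a (double⁺ j))
            y = f (a (double⁺ j +⁺ one⁺) , a k)
        in A x × A y × A (f (x , y))
theorem2 U dagger A A∈f⊗ = a ∘ val , λ i j k i<2j 2j+1<k →
  let x∈A , y∈A , 2^xy∈A = a-shape (val i) (val j) (val k) i<2j 2j+1<k
  in  x∈A , y∈A ,
      subst A (sym (f-merge (f (a (val i) , a (2 * val j))) (a (2 * val j + 1)) (a (val k)))) 2^xy∈A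
  where open Construction U dagger (λ n m → A (f (n , m))) A∈f⊗
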